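{- Let $q$ be a power of an odd prime, and suppose either $d \geq 3$, or $d = 2$ and $q \equiv 1 \pmod 4$. Then there exist disjoint sets $A,B \subset \mathbb{F}_q^d$ such that $|A|^2|B| = q^{d+2}(1+o(1))$ as $q \to \infty$, and there are no $x,y \in A$, $z \in B$ for which $(x,y,z)$ forms a right angle.
   Context: An ordered triple $(x,y,z)$ of points of $\mathbb{F}_q^d$ forms a right angle if $x,y,z$ are distinct and $(x-y)\cdot(z-y) = 0$, where $u\cdot v=\sum_i u_iv_i$. -}

module Defs where

open import Level using (0ℓ)
open import Data.Nat using (ℕ; suc; _*_; _^_; _%_)
open import Data.Nat.Primality using (Prime)
open import Data.Fin using (Fin)
open import Data.Vec using (Vec; zipWith; foldr)
open import Data.List using (List)
open import Data.List.Membership.Propositional using (_∈_)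
open import Data.Product using (_×_; ∃; Σ)
open import Relation.Nullary using (¬_)
open import Relation.Binary.PropositionalEquality using (_≡_)
open import Algebra.Core using (Op₁; Op₂)
open import Algebra.Structures using (IsCommutativeRing)
open import Function.Bundles using (_↔_)

record FiniteField : Set₁ where
  field
    Carrier : Set
    _+_ _·_ : Op₂ Carrier
    -_ : Op₁ Carrier
    0# 1# : Carrier
    isCommutativeRing : IsCommutativeRing _≡_ _+_ _·_ -_ 0# 1#
    0≢1 : ¬ (0# ≡ 1#)
    inverse : ∀ x → ¬ (x ≡ 0#) → ∃ λ y → (x · y) ≡ 1#
    size : ℕ
    enumeration : Fin size ↔ Carrier

module _ (F : FiniteField) where
  open FiniteField F

  Point : ℕ → Set
  Point d = Vec Carrier d

  _-ᵥ_ : ∀ {d} → Point d → Point d → Point d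
  u -ᵥ v = zipWith (λ a b → a + (- b)) u v

  dot : ∀ {d} → Point d → Point d → Carrier
  dot u v = foldr _ _+_ 0# (zipWith _·_ u v)

  RightAngle : ∀ {d} → Point d → Point d → Point d → Set
  RightAngle x y z =
    ¬ (x ≡ y) × ¬ (y ≡ z) × ¬ (x ≡ z) × dot (x -ᵥ y) (z -ᵥ y) ≡ 0#

OddPrimePower : ℕ → Set
OddPrimePower q = Σ ℕ λ p → Σ ℕ λ k → Prime p × (p % 2 ≡ 1) × (q ≡ p ^ suc k)

module Submission where

-- Let q be odd and v = (1, w) ∈ F_q^d with w · w = -1, so v · v = 0. Take A = F_q·v and
-- B = {z : v · z ≠ 0}. For x = s v, y = t v in A and z in B,
--   (x - y) · (z - y) = (s - t) (v · z)   (because v · v = 0),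
-- which is nonzero when x ≠ y; so A × A × B contains no right angle, A ∩ B = ∅, |A| = q
-- and q^d - q^(d-1) ≤ |B| ≤ q^d, whence |A|²|B| = q^(d+2) (1 + O(1/q)).
--
-- The vector w exists for d ≥ 3 because -1 is a sum of two squares in any field of odd
-- order, and for d = 2 because -1 is a square when q ≡ 1 (mod 4).

open import Defs

module ListCounting where

  open import Data.Nat using (ℕ; suc; _+_; _*_; _≤_; _<_; _<?_; _⊓_; z≤n; s≤s)
  import Data.Nat as ℕ
  open import Data.Nat.Properties using (≤-trans; ≤-antisym; +-suc; +-identityʳ; <-cmp; <-irrefl; <-asym; ⊓-sel; ⊓-comm; *-assoc)
  open import Data.List using (List; []; _∷_; _++_; length; filter; map; cartesianProductWith)
  open import Data.List.Properties using (filter-notAll; filter-accept; filter-reject; filter-none; length-map; length-++)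
  open import Data.List.Membership.Propositional using (_∈_; lose)
  open import Data.List.Membership.Propositional.Properties using (∈-filter⁺; ∈-filter⁻; ∈-map⁻; ∈-++⁻)
  open import Data.List.Relation.Unary.Any as Any using (Any; here; there; any?)
  import Data.List.Relation.Unary.All as All
  open import Data.List.Relation.Unary.Unique.Propositional using (Unique)
  open import Data.List.Relation.Unary.Unique.Propositional.Properties using (filter⁺; map⁺; ++⁺)
  open import Data.List.Relation.Unary.AllPairs using (_∷_)
  open import Data.Product using (∃; _×_; _,_; proj₁; proj₂)
  open import Data.Sum using (_⊎_; inj₁; inj₂; [_,_])
  open import Data.Empty using (⊥-elim)
  open import Function using (_∘_; id)
  open import Relation.Nullary using (¬_; yes; no; ¬?)
  open import Relation.Nullary.Decidable using (map′)
  open import Relation.Unary using (Decidable)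
  open import Relation.Binary.Definitions using (DecidableEquality; tri<; tri≈; tri>)
  open import Relation.Binary.PropositionalEquality hiding ([_])
  open ≡-Reasoning

  module _ {X Y : Set} (_≟_ : DecidableEquality Y) where

    length-≤-by-injection : (f : X → Y) (xs : List X) (ys : List Y) → Unique xs →
      (∀ {x y} → x ∈ xs → y ∈ xs → f x ≡ f y → x ≡ y) →
      (∀ {x} → x ∈ xs → f x ∈ ys) → length xs ≤ length ys
    length-≤-by-injection f [] ys _ _ _ = z≤n
    length-≤-by-injection f (x ∷ xs) ys (x∉xs ∷ unique) injective into =
      ≤-trans (s≤s (length-≤-by-injection f xs ys′ unique (λ a b → injective (there a) (there b)) into′))
              (filter-notAll other? ys (Any.map (λ eq ne → ne (sym eq)) (into (here refl))))
      where
        -- ys with the image of x removed still receives the rest of xs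
        other? : Decidable (λ y → ¬ y ≡ f x)
        other? y = ¬? (y ≟ f x)
        ys′ : List Y
        ys′ = filter other? ys
        into′ : ∀ {a} → a ∈ xs → f a ∈ ys′
        into′ {a} a∈xs = ∈-filter⁺ other? (into (there a∈xs))
          (λ fa≡fx → All.lookup x∉xs a∈xs (sym (injective (there a∈xs) (here refl) fa≡fx)))

  same-members-length : ∀ {X : Set} → DecidableEquality X → {xs ys : List X} →
    Unique xs → Unique ys → (∀ {x} → x ∈ xs → x ∈ ys) → (∀ {y} → y ∈ ys → y ∈ xs) →
    length xs ≡ length ys
  same-members-length _≟_ {xs} {ys} uxs uys xs⊆ys ys⊆xs =
    ≤-antisym (length-≤-by-injection _≟_ id xs ys uxs (λ _ _ → id) xs⊆ys)
              (length-≤-by-injection _≟_ id ys xs uys (λ _ _ → id) ys⊆xs)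

  filter-length : ∀ {X : Set} {P : X → Set} → DecidableEquality X → (P? : Decidable P) →
    (L ys : List X) → Unique L → Unique ys →
    (∀ {x} → x ∈ L → P x → x ∈ ys) → (∀ {y} → y ∈ ys → y ∈ L × P y) →
    length (filter P? L) ≡ length ys
  filter-length _≟_ P? L ys uL uys sound complete =
    same-members-length _≟_ (filter⁺ P? uL) uys
      (λ x∈ → let (x∈L , Px) = ∈-filter⁻ P? x∈ in sound x∈L Px)
      (λ y∈ → let (y∈L , Py) = complete y∈ in ∈-filter⁺ P? y∈L Py)

  length-split : ∀ {X : Set} {P : X → Set} (P? : Decidable P) (xs : List X) →
    length xs ≡ length (filter P? xs) + length (filter (¬? ∘ P?) xs)
  length-split P? [] = refl
  length-split P? (x ∷ xs) with P? x
  ... | yes _ = cong suc (length-split P? xs)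
  ... | no _ = trans (cong suc (length-split P? xs)) (sym (+-suc _ _))

  length-cartesianProductWith : ∀ {A B C : Set} (f : A → B → C) (xs : List A) (ys : List B) →
    length (cartesianProductWith f xs ys) ≡ length xs * length ys
  length-cartesianProductWith f [] ys = refl
  length-cartesianProductWith f (x ∷ xs) ys = begin
    length (map (f x) ys ++ cartesianProductWith f xs ys)          ≡⟨ length-++ (map (f x) ys) ⟩
    length (map (f x) ys) + length (cartesianProductWith f xs ys)  ≡⟨ cong₂ _+_ (length-map (f x) ys) (length-cartesianProductWith f xs ys) ⟩
    length ys + length xs * length ys                              ∎

  -- Counting an involution τ on a duplicate-free list L closed under τ: the members
  -- not fixed by τ come in pairs {x, τ x}; a key separating each such pair selects
  -- one member of every pair, so |L| = |Fixed| + 2·|Below|.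
  module InvolutionCount {X : Set} (_≟_ : DecidableEquality X) (key : X → ℕ) (τ : X → X)
    (L : List X) (closed : ∀ {x} → x ∈ L → τ x ∈ L) (involutive : ∀ {x} → x ∈ L → τ (τ x) ≡ x)
    (key-separates : ∀ {x} → x ∈ L → key x ≡ key (τ x) → τ x ≡ x) where

    fixed? : Decidable (λ x → τ x ≡ x)
    fixed? x = τ x ≟ x

    below? : Decidable (λ x → key x < key (τ x))
    below? x = key x <? key (τ x)

    above? : Decidable (λ x → key (τ x) < key x)
    above? x = key (τ x) <? key x

    Fixed Below Above : List X
    Fixed = filter fixed? L
    Below = filter below? L
    Above = filter above? L

    trichotomy : (M : List X) → (∀ {x} → x ∈ M → x ∈ L) →
      length M ≡ length (filter fixed? M) + (length (filter below? M) + length (filter above? M))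
    trichotomy [] _ = refl
    trichotomy (x ∷ M) M⊆L with ih ← trichotomy M (M⊆L ∘ there) | <-cmp (key x) (key (τ x))
    ... | tri< lt ¬eq _
      rewrite filter-reject fixed? {xs = M} (λ fx → ¬eq (cong key (sym fx)))
            | filter-accept below? {xs = M} lt
            | filter-reject above? {xs = M} (<-asym lt)
            = trans (cong suc ih) (sym (+-suc _ _))
    ... | tri≈ ¬lt eq ¬gt
      rewrite filter-accept fixed? {xs = M} (key-separates (M⊆L (here refl)) eq)
            | filter-reject below? {xs = M} ¬lt
            | filter-reject above? {xs = M} ¬gt
            = cong suc ih
    ... | tri> ¬lt ¬eq gt
      rewrite filter-reject fixed? {xs = M} (λ fx → ¬eq (cong key (sym fx)))
            | filter-reject below? {xs = M} ¬lt
            | filter-accept above? {xs = M} gt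
            = trans (cong suc ih) (sym (trans (cong (nf +_) (+-suc nb na)) (+-suc nf (nb + na))))
      where
        nf nb na : ℕ
        nf = length (filter fixed? M)
        nb = length (filter below? M)
        na = length (filter above? M)

    -- τ exchanges Below and Above, so they have the same length
    below-to-above : ∀ {x} → x ∈ Below → τ x ∈ Above
    below-to-above x∈B with ∈-filter⁻ below? x∈B
    ... | x∈L , lt = ∈-filter⁺ above? (closed x∈L) (subst (λ y → key y < key (τ _)) (sym (involutive x∈L)) lt)

    above-to-below : ∀ {x} → x ∈ Above → τ x ∈ Below
    above-to-below x∈A with ∈-filter⁻ above? x∈A
    ... | x∈L , gt = ∈-filter⁺ below? (closed x∈L) (subst (λ y → key (τ _) < key y) (sym (involutive x∈L)) gt)

    τ-injective : ∀ {x y} → x ∈ L → y ∈ L → τ x ≡ τ y → x ≡ y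
    τ-injective x∈L y∈L eq = trans (sym (involutive x∈L)) (trans (cong τ eq) (involutive y∈L))

    count : Unique L → length L ≡ length Fixed + 2 * length Below
    count unique = trans (trichotomy L id) (cong (length Fixed +_) pairs)
      where
        in-L : ∀ {P : X → Set} (P? : Decidable P) {x} → x ∈ filter P? L → x ∈ L
        in-L P? = proj₁ ∘ ∈-filter⁻ P?
        below≤above : length Below ≤ length Above
        below≤above = length-≤-by-injection _≟_ τ Below Above (filter⁺ below? unique)
          (λ a b → τ-injective (in-L below? a) (in-L below? b)) below-to-above
        above≤below : length Above ≤ length Below
        above≤below = length-≤-by-injection _≟_ τ Above Below (filter⁺ above? unique)
          (λ a b → τ-injective (in-L above? a) (in-L above? b)) above-to-below
        pairs : length Below + length Above ≡ 2 * length Below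
        pairs = cong (length Below +_) (trans (≤-antisym above≤below below≤above) (sym (+-identityʳ _)))

  -- Counting on a type with an injective numbering idx (for instance a finite field
  -- via its enumeration); the numbering supplies decidable equality and keys.
  module Indexed {X : Set} (idx : X → ℕ) (idx-injective : ∀ {x y} → idx x ≡ idx y → x ≡ y) where

    _≟_ : DecidableEquality X
    x ≟ y = map′ idx-injective (cong idx) (idx x ℕ.≟ idx y)

    even-length : (σ : X → X) (L : List X) → Unique L →
      (∀ {x} → x ∈ L → σ x ∈ L) → (∀ {x} → x ∈ L → σ (σ x) ≡ x) →
      (∀ {x} → x ∈ L → ¬ σ x ≡ x) → ∃ λ m → length L ≡ 2 * m
    even-length σ L unique closed involutive free =
      length Below , trans (count unique) (cong (_+ 2 * length Below) no-fixed)
      where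
        separates : ∀ {x} → x ∈ L → idx x ≡ idx (σ x) → σ x ≡ x
        separates _ eq = sym (idx-injective eq)
        open InvolutionCount _≟_ idx σ L closed involutive separates
        no-fixed : length Fixed ≡ 0
        no-fixed = cong length (filter-none fixed? (All.tabulate free))

    -- Two commuting involutions σ, τ of L, with σ and σ ∘ τ fixed-point-free, generate a
    -- four-element group acting on L; its orbits have four elements, except the orbits
    -- {x, σ x} of the τ-fixed points.
    klein-four-count : (σ τ : X → X) (L : List X) → Unique L →
      (∀ {x} → x ∈ L → σ x ∈ L) → (∀ {x} → x ∈ L → τ x ∈ L) →
      (∀ {x} → x ∈ L → σ (σ x) ≡ x) → (∀ {x} → x ∈ L → τ (τ x) ≡ x) →
      (∀ {x} → x ∈ L → σ (τ x) ≡ τ (σ x)) →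
      (∀ {x} → x ∈ L → ¬ σ x ≡ x) → (∀ {x} → x ∈ L → ¬ σ (τ x) ≡ x) →
      ∃ λ m → length L ≡ length (filter (λ x → τ x ≟ x) L) + 4 * m
    klein-four-count σ τ L unique σ-closed τ-closed σσ ττ commute σ-free στ-free =
      proj₁ Below-even , trans (count unique) (cong (length Fixed +_) (begin
        2 * length Below            ≡⟨ cong (2 *_) (proj₂ Below-even) ⟩
        2 * (2 * proj₁ Below-even)  ≡⟨ sym (*-assoc 2 2 (proj₁ Below-even)) ⟩
        4 * proj₁ Below-even        ∎))
      where
        -- a key shared by x and σ x: the smaller of their indices
        orbitKey : X → ℕ
        orbitKey x = idx x ⊓ idx (σ x)

        orbitKey-σ : ∀ {x} → x ∈ L → orbitKey (σ x) ≡ orbitKey x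
        orbitKey-σ {x} x∈L = trans (cong (λ y → idx (σ x) ⊓ idx y) (σσ x∈L)) (⊓-comm (idx (σ x)) (idx x))

        σ-injective : ∀ {x y} → x ∈ L → y ∈ L → σ x ≡ σ y → x ≡ y
        σ-injective x∈L y∈L eq = trans (sym (σσ x∈L)) (trans (cong σ eq) (σσ y∈L))

        -- equal orbit keys identify one of x, σ x with one of τ x, σ (τ x)
        match : ∀ {x a b} → orbitKey x ≡ orbitKey (τ x) → orbitKey x ≡ idx a → orbitKey (τ x) ≡ idx b → a ≡ b
        match eq ka kb = idx-injective (trans (sym ka) (trans eq kb))

        -- of these identifications only τ x ≡ x is possible
        separates : ∀ {x} → x ∈ L → orbitKey x ≡ orbitKey (τ x) → τ x ≡ x
        separates {x} x∈L eq with ⊓-sel (idx x) (idx (σ x)) | ⊓-sel (idx (τ x)) (idx (σ (τ x)))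
        ... | inj₁ kx | inj₁ kτx = sym (match eq kx kτx)
        ... | inj₁ kx | inj₂ kτx = ⊥-elim (στ-free x∈L (sym (match eq kx kτx)))
        ... | inj₂ kx | inj₁ kτx = ⊥-elim (στ-free x∈L (trans (cong σ (sym (match eq kx kτx))) (σσ x∈L)))
        ... | inj₂ kx | inj₂ kτx = sym (σ-injective x∈L (τ-closed x∈L) (match eq kx kτx))

        open InvolutionCount _≟_ orbitKey τ L τ-closed ττ separates

        in-L : ∀ {x} → x ∈ Below → x ∈ L
        in-L = proj₁ ∘ ∈-filter⁻ below?

        Below-closed : ∀ {x} → x ∈ Below → σ x ∈ Below
        Below-closed {x} x∈B with ∈-filter⁻ below? x∈B
        ... | x∈L , lt = ∈-filter⁺ below? (σ-closed x∈L)
          (subst₂ _<_ (sym (orbitKey-σ x∈L))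
                      (trans (sym (orbitKey-σ (τ-closed x∈L))) (cong orbitKey (commute x∈L))) lt)

        Below-even : ∃ λ n → length Below ≡ 2 * n
        Below-even = even-length σ Below (filter⁺ below? unique) Below-closed (σσ ∘ in-L) (σ-free ∘ in-L)

  images-meet : ∀ {X Y : Set} → DecidableEquality Y → (f g : X → Y) (L : List X) (M : List Y) →
    Unique L →
    (∀ {x y} → x ∈ L → y ∈ L → f x ≡ f y → x ≡ y) →
    (∀ {x y} → x ∈ L → y ∈ L → g x ≡ g y → x ≡ y) →
    (∀ y → y ∈ M) → length M < 2 * length L → ∃ λ a → ∃ λ b → f a ≡ g b
  images-meet {X} {Y} _≟_ f g L M unique f-inj g-inj complete small
    with any? (λ a → any? (λ b → f a ≟ g b) L) L
  ... | yes meet = let (a , b-meets) = Any.satisfied meet in a , Any.satisfied b-meets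
  ... | no apart = ⊥-elim (<-irrefl refl (≤-trans small tagged-fit))
    where
      Tagged : List (X ⊎ X)
      Tagged = map inj₁ L ++ map inj₂ L

      untag : ∀ {u} → u ∈ Tagged → (∃ λ a → a ∈ L × u ≡ inj₁ a) ⊎ (∃ λ b → b ∈ L × u ≡ inj₂ b)
      untag u∈T with ∈-++⁻ (map inj₁ L) u∈T
      ... | inj₁ u∈₁ = inj₁ (∈-map⁻ inj₁ u∈₁)
      ... | inj₂ u∈₂ = inj₂ (∈-map⁻ inj₂ u∈₂)

      Tagged-unique : Unique Tagged
      Tagged-unique = ++⁺ (map⁺ (λ { refl → refl }) unique) (map⁺ (λ { refl → refl }) unique) tags-differ
        where
          tags-differ : ∀ {u} → ¬ (u ∈ map inj₁ L × u ∈ map inj₂ L)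
          tags-differ (u∈₁ , u∈₂) with ∈-map⁻ inj₁ u∈₁ | ∈-map⁻ inj₂ u∈₂
          ... | _ , _ , refl | _ , _ , ()

      value : X ⊎ X → Y
      value = [ f , g ]

      value-injective : ∀ {u v} → u ∈ Tagged → v ∈ Tagged → value u ≡ value v → u ≡ v
      value-injective u∈T v∈T eq with untag u∈T | untag v∈T
      ... | inj₁ (a , a∈L , refl) | inj₁ (b , b∈L , refl) = cong inj₁ (f-inj a∈L b∈L eq)
      ... | inj₁ (a , a∈L , refl) | inj₂ (b , b∈L , refl) = ⊥-elim (apart (lose a∈L (lose b∈L eq)))
      ... | inj₂ (a , a∈L , refl) | inj₁ (b , b∈L , refl) = ⊥-elim (apart (lose b∈L (lose a∈L (sym eq))))
      ... | inj₂ (a , a∈L , refl) | inj₂ (b , b∈L , refl) = cong inj₂ (g-inj a∈L b∈L eq)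

      Tagged-length : length Tagged ≡ 2 * length L
      Tagged-length = begin
        length Tagged                               ≡⟨ length-++ (map inj₁ L) ⟩
        length (map inj₁ L) + length (map inj₂ L)   ≡⟨ cong₂ _+_ (length-map inj₁ L) (length-map inj₂ L) ⟩
        length L + length L                         ≡⟨ cong (length L +_) (sym (+-identityʳ (length L))) ⟩
        2 * length L                                ∎

      tagged-fit : 2 * length L ≤ length M
      tagged-fit = subst (_≤ length M) Tagged-length
        (length-≤-by-injection _≟_ value Tagged M Tagged-unique value-injective (λ {u} _ → complete (value u)))

module Residues where

  open import Data.Nat using (zero; suc; _+_; _*_; _^_; _%_)
  open import Data.Nat.Properties using (1+n≢0; suc-injective; *-comm)
  open import Data.Nat.DivMod using (m*n%n≡0; [m+kn]%n≡m%n; %-distribˡ-*)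
  open import Data.Product using (_,_)
  open import Relation.Binary.PropositionalEquality

  2m%2≢1 : ∀ m → (2 * m) % 2 ≢ 1
  2m%2≢1 m eq = 1+n≢0 (trans (sym eq) (trans (cong (_% 2) (*-comm 2 m)) (m*n%n≡0 m 2)))

  3+4m%4≢1 : ∀ m → (3 + 4 * m) % 4 ≢ 1
  3+4m%4≢1 m eq = 1+n≢0 (suc-injective (trans (sym ([m+kn]%n≡m%n 3 m 4)) (trans (cong (λ n → (3 + n) % 4) (*-comm m 4)) eq)))

  odd-power : ∀ p k → p % 2 ≡ 1 → (p ^ k) % 2 ≡ 1
  odd-power p zero _ = refl
  odd-power p (suc k) p-odd = trans (%-distribˡ-* p (p ^ k) 2)
    (cong₂ (λ a b → (a * b) % 2) p-odd (odd-power p k p-odd))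

  odd-prime-power-odd : ∀ {q} → OddPrimePower q → q % 2 ≡ 1
  odd-prime-power-odd (p , k , _ , p-odd , q≡p^k+1) = trans (cong (_% 2) q≡p^k+1) (odd-power p (suc k) p-odd)

module SizeEstimate where

  open import Data.Nat using (suc; _+_; _*_; _^_; _≤_; ∣_-_∣)
  open import Data.Nat.Properties using (^-distribˡ-+-*; ∣m-m+n∣≡n; *-distribˡ-+; +-comm; *-monoˡ-≤; *-monoʳ-≤; module ≤-Reasoning)
  open import Data.Nat.Tactic.RingSolver using (solve-∀)
  open import Relation.Binary.PropositionalEquality

  deviation-bound : ∀ q k e z b → suc k ≤ q → q * q ^ e ≡ z + b → z ≤ q ^ e →
    suc k * ∣ q * q * b - q ^ (suc e + 2) ∣ ≤ q ^ (suc e + 2)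
  deviation-bound q k e z b k<q split z≤q^e =
    subst (λ n → suc k * ∣ q * q * b - n ∣ ≤ n) (sym total)
      (subst (λ n → suc k * n ≤ q * q * b + q * q * z) (sym (∣m-m+n∣≡n (q * q * b) (q * q * z))) (begin
        suc k * (q * q * z)          ≤⟨ *-monoˡ-≤ (q * q * z) k<q ⟩
        q * (q * q * z)              ≡⟨ rearrange q z ⟩
        q * q * (q * z)              ≤⟨ *-monoʳ-≤ (q * q) (*-monoʳ-≤ q z≤q^e) ⟩
        q * q * (q * q ^ e)          ≡⟨ power-split ⟨
        q ^ (suc e + 2)              ≡⟨ total ⟩
        q * q * b + q * q * z        ∎))
    where
      open ≤-Reasoning
      rearrange : ∀ q z → q * (q * q * z) ≡ q * q * (q * z)
      rearrange = solve-∀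
      regroup : ∀ q Q → q * Q * (q * (q * 1)) ≡ q * q * (q * Q)
      regroup = solve-∀
      power-split : q ^ (suc e + 2) ≡ q * q * (q * q ^ e)
      power-split = trans (^-distribˡ-+-* q (suc e) 2) (regroup q (q ^ e))
      total : q ^ (suc e + 2) ≡ q * q * b + q * q * z
      total = begin-equality
        q ^ (suc e + 2)              ≡⟨ power-split ⟩
        q * q * (q * q ^ e)          ≡⟨ cong (q * q *_) split ⟩
        q * q * (z + b)              ≡⟨ *-distribˡ-+ (q * q) z b ⟩
        q * q * z + q * q * b        ≡⟨ +-comm (q * q * z) (q * q * b) ⟩
        q * q * b + q * q * z        ∎

module FiniteFieldFacts (F : FiniteField) where

  open import Level using (0ℓ)
  open import Algebra.Bundles using (CommutativeRing)
  open import Algebra.Structures using (IsCommutativeRing)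
  open import Data.Nat using (ℕ)
  import Data.Nat as ℕ
  import Data.Nat.Properties as ℕP
  open import Data.Fin using (toℕ)
  open import Data.Fin.Properties using (toℕ-injective)
  open import Data.List using (List; []; _∷_; length; map; filter; allFin)
  open import Data.List.Properties using (length-map; length-tabulate)
  open import Data.List.Membership.Propositional using (_∈_; lose)
  open import Data.List.Membership.Propositional.Properties using (∈-map⁺; ∈-allFin; ∈-filter⁺; ∈-filter⁻)
  open import Data.List.Relation.Unary.Any as Any using (here; there; any?)
  import Data.List.Relation.Unary.All as All
  open import Data.List.Relation.Unary.AllPairs using ([]; _∷_)
  open import Data.List.Relation.Unary.Unique.Propositional using (Unique)
  open import Data.List.Relation.Unary.Unique.Propositional.Properties using (map⁺; allFin⁺; filter⁺)
  open import Data.Product using (∃; _×_; _,_; proj₁; proj₂)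
  open import Data.Sum using (_⊎_; inj₁; inj₂)
  open import Data.Empty using (⊥-elim)
  open import Function using (_∘_)
  open import Function.Bundles using (Inverse)
  open import Relation.Nullary using (¬_; Dec; yes; no; ¬?)
  open import Relation.Unary using (Decidable)
  open import Relation.Binary.PropositionalEquality
  open ≡-Reasoning

  open FiniteField F
  open IsCommutativeRing isCommutativeRing
    using (+-assoc; +-comm; +-identityˡ; +-identityʳ; -‿inverseˡ; -‿inverseʳ;
           *-assoc; *-comm; *-identityˡ; *-identityʳ; distribˡ; distribʳ; zeroˡ; zeroʳ)

  commutativeRing : CommutativeRing 0ℓ 0ℓ
  commutativeRing = record { isCommutativeRing = isCommutativeRing }

  open import Algebra.Properties.Ring (CommutativeRing.ring commutativeRing)
    using (-‿involutive; -‿injective; -0#≈0#; -‿distribˡ-*; -‿distribʳ-*; -‿anti-homo-+;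
           +-inverseˡ-unique; x∙y⁻¹≈ε⇒x≈y; +-cancelˡ; [y-z]x≈yx-zx)

  q : ℕ
  q = size

  open Inverse enumeration using (to; from; strictlyInverseˡ; strictlyInverseʳ)

  idx : Carrier → ℕ
  idx x = toℕ (from x)

  idx-injective : ∀ {x y} → idx x ≡ idx y → x ≡ y
  idx-injective {x} {y} eq = begin
    x              ≡⟨ strictlyInverseˡ x ⟨
    to (from x)    ≡⟨ cong to (toℕ-injective eq) ⟩
    to (from y)    ≡⟨ strictlyInverseˡ y ⟩
    y              ∎

  open ListCounting.Indexed idx idx-injective public using (_≟_)

  elements : List Carrier
  elements = map to (allFin q)

  ∈-elements : ∀ x → x ∈ elements
  ∈-elements x = subst (_∈ elements) (strictlyInverseˡ x) (∈-map⁺ to (∈-allFin (from x)))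

  elements-unique : Unique elements
  elements-unique = map⁺ to-injective (allFin⁺ q)
    where
      to-injective : ∀ {i j} → to i ≡ to j → i ≡ j
      to-injective {i} {j} eq = trans (sym (strictlyInverseʳ i)) (trans (cong from eq) (strictlyInverseʳ j))

  elements-length : length elements ≡ q
  elements-length = trans (length-map to (allFin q)) (length-tabulate {n = q} (λ i → i))

  zero-product : ∀ {a b} → a · b ≡ 0# → a ≡ 0# ⊎ b ≡ 0#
  zero-product {a} {b} ab≡0 with a ≟ 0#
  ... | yes a≡0 = inj₁ a≡0
  ... | no a≢0 with inverse a a≢0
  ...   | a′ , aa′≡1 = inj₂ (begin
    b              ≡⟨ *-identityˡ b ⟨
    1# · b         ≡⟨ cong (_· b) (trans (*-comm a′ a) aa′≡1) ⟨
    (a′ · a) · b   ≡⟨ *-assoc a′ a b ⟩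
    a′ · (a · b)   ≡⟨ cong (a′ ·_) ab≡0 ⟩
    a′ · 0#        ≡⟨ zeroʳ a′ ⟩
    0#             ∎)

  neg-·-neg : ∀ a b → (- a) · (- b) ≡ a · b
  neg-·-neg a b = begin
    (- a) · (- b)   ≡⟨ -‿distribˡ-* a (- b) ⟨
    - (a · (- b))   ≡⟨ cong -_ (-‿distribʳ-* a b) ⟨
    - (- (a · b))   ≡⟨ -‿involutive (a · b) ⟩
    a · b           ∎

  difference-of-squares : ∀ x y → (x + (- y)) · (x + y) ≡ (x · x) + (- (y · y))
  difference-of-squares x y = begin
    (x + (- y)) · (x + y)                                    ≡⟨ [y-z]x≈yx-zx (x + y) x y ⟩
    (x · (x + y)) + (- (y · (x + y)))                        ≡⟨ cong₂ (λ u v → u + (- v)) (distribˡ x x y) (distribˡ y x y) ⟩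
    ((x · x) + (x · y)) + (- ((y · x) + (y · y)))            ≡⟨ cong (λ u → ((x · x) + (x · y)) + (- (u + (y · y)))) (*-comm y x) ⟩
    ((x · x) + (x · y)) + (- ((x · y) + (y · y)))            ≡⟨ cong (((x · x) + (x · y)) +_) (-‿anti-homo-+ (x · y) (y · y)) ⟩
    ((x · x) + (x · y)) + ((- (y · y)) + (- (x · y)))        ≡⟨ cong (((x · x) + (x · y)) +_) (+-comm (- (y · y)) (- (x · y))) ⟩
    ((x · x) + (x · y)) + ((- (x · y)) + (- (y · y)))        ≡⟨ +-assoc (x · x) (x · y) _ ⟩
    (x · x) + ((x · y) + ((- (x · y)) + (- (y · y))))        ≡⟨ cong ((x · x) +_) (+-assoc (x · y) (- (x · y)) (- (y · y))) ⟨
    (x · x) + (((x · y) + (- (x · y))) + (- (y · y)))        ≡⟨ cong (λ u → (x · x) + (u + (- (y · y)))) (-‿inverseʳ (x · y)) ⟩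
    (x · x) + (0# + (- (y · y)))                             ≡⟨ cong ((x · x) +_) (+-identityˡ (- (y · y))) ⟩
    (x · x) + (- (y · y))                                    ∎

  equal-squares : ∀ {x y} → x · x ≡ y · y → x ≡ y ⊎ x ≡ - y
  equal-squares {x} {y} xx≡yy with zero-product (trans (difference-of-squares x y)
                                     (trans (cong (_+ (- (y · y))) xx≡yy) (-‿inverseʳ (y · y))))
  ... | inj₁ x-y≡0 = inj₁ (x∙y⁻¹≈ε⇒x≈y x y x-y≡0)
  ... | inj₂ x+y≡0 = inj₂ (+-inverseˡ-unique x y x+y≡0)

  1≢0 : ¬ 1# ≡ 0#
  1≢0 1≡0 = 0≢1 (sym 1≡0)

  -- The multiplicative inverse, extended by 0⁻¹ = 0 to a total function.
  _⁻¹ : Carrier → Carrier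
  x ⁻¹ with x ≟ 0#
  ... | yes _ = 0#
  ... | no x≢0 = proj₁ (inverse x x≢0)

  ⁻¹-inverse : ∀ {x} → ¬ x ≡ 0# → x · (x ⁻¹) ≡ 1#
  ⁻¹-inverse {x} x≢0 with x ≟ 0#
  ... | yes x≡0 = ⊥-elim (x≢0 x≡0)
  ... | no x≢0′ = proj₂ (inverse x x≢0′)

  inverse-unique : ∀ {x y} → x · y ≡ 1# → y ≡ x ⁻¹
  inverse-unique {x} {y} xy≡1 = begin
    y                    ≡⟨ *-identityʳ y ⟨
    y · 1#               ≡⟨ cong (y ·_) (⁻¹-inverse x≢0) ⟨
    y · (x · (x ⁻¹))     ≡⟨ *-assoc y x (x ⁻¹) ⟨
    (y · x) · (x ⁻¹)     ≡⟨ cong (_· (x ⁻¹)) (trans (*-comm y x) xy≡1) ⟩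
    1# · (x ⁻¹)          ≡⟨ *-identityˡ (x ⁻¹) ⟩
    x ⁻¹                 ∎
    where
      x≢0 : ¬ x ≡ 0#
      x≢0 x≡0 = 1≢0 (trans (sym xy≡1) (trans (cong (_· y) x≡0) (zeroˡ y)))

  ⁻¹-nonzero : ∀ {x} → ¬ x ≡ 0# → ¬ x ⁻¹ ≡ 0#
  ⁻¹-nonzero {x} x≢0 x⁻¹≡0 = 1≢0 (trans (sym (⁻¹-inverse x≢0)) (trans (cong (x ·_) x⁻¹≡0) (zeroʳ x)))

  ⁻¹-involutive : ∀ {x} → ¬ x ≡ 0# → (x ⁻¹) ⁻¹ ≡ x
  ⁻¹-involutive {x} x≢0 = sym (inverse-unique (trans (*-comm (x ⁻¹) x) (⁻¹-inverse x≢0)))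

  ⁻¹-neg : ∀ {x} → ¬ x ≡ 0# → (- x) ⁻¹ ≡ - (x ⁻¹)
  ⁻¹-neg {x} x≢0 = sym (inverse-unique (trans (neg-·-neg x (x ⁻¹)) (⁻¹-inverse x≢0)))

  neg-nonzero : ∀ {x} → ¬ x ≡ 0# → ¬ (- x) ≡ 0#
  neg-nonzero {x} x≢0 -x≡0 = x≢0 (trans (sym (-‿involutive x)) (trans (cong -_ -x≡0) -0#≈0#))

  nonzero? : Decidable (λ x → ¬ x ≡ 0#)
  nonzero? = ¬? ∘ (_≟ 0#)

  Nonzero : List Carrier
  Nonzero = filter nonzero? elements

  Nonzero-unique : Unique Nonzero
  Nonzero-unique = filter⁺ nonzero? elements-unique

  nonzero : ∀ {x} → x ∈ Nonzero → ¬ x ≡ 0#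
  nonzero = proj₂ ∘ ∈-filter⁻ nonzero? {xs = elements}

  nonzero⁺ : ∀ {x} → ¬ x ≡ 0# → x ∈ Nonzero
  nonzero⁺ {x} = ∈-filter⁺ nonzero? (∈-elements x)

  q≡1+|Nonzero| : q ≡ 1 ℕ.+ length Nonzero
  q≡1+|Nonzero| = begin
    q                                                      ≡⟨ elements-length ⟨
    length elements                                        ≡⟨ ListCounting.length-split (_≟ 0#) elements ⟩
    length (filter (_≟ 0#) elements) ℕ.+ length Nonzero    ≡⟨ cong (ℕ._+ length Nonzero) zero-count ⟩
    1 ℕ.+ length Nonzero                                   ∎
    where
      zero-count : length (filter (_≟ 0#) elements) ≡ 1
      zero-count = ListCounting.filter-length _≟_ (_≟ 0#) elements (0# ∷ []) elements-unique
        (All.[] ∷ []) (λ _ x≡0 → here x≡0) (λ { (here refl) → ∈-elements 0# , refl })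

  module OddOrder (q-odd : q ℕ.% 2 ≡ 1) where

    open ListCounting.Indexed idx idx-injective using (even-length; klein-four-count)

    -- 1 + 1 ≠ 0, since otherwise x ↦ x + 1 would be a fixed-point-free involution of
    -- the field, making q even.
    two≢0 : ¬ 1# + 1# ≡ 0#
    two≢0 2≡0 with even-length (_+ 1#) elements elements-unique (λ {x} _ → ∈-elements (x + 1#))
                                (λ {x} _ → trans (+-assoc x 1# 1#) (trans (cong (x +_) 2≡0) (+-identityʳ x)))
                                (λ {x} _ x+1≡x → 1≢0 (+-cancelˡ x 1# 0# (trans x+1≡x (sym (+-identityʳ x)))))
    ... | m , length≡2m = Residues.2m%2≢1 m (trans (cong (ℕ._% 2) (trans (sym length≡2m) elements-length)) q-odd)

    -- negation fixes only 0, because x + x = (1 + 1) · x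
    neg-fixed⇒zero : ∀ {x} → - x ≡ x → x ≡ 0#
    neg-fixed⇒zero {x} -x≡x with zero-product 2x≡0
      where
        2x≡0 : (1# + 1#) · x ≡ 0#
        2x≡0 = begin
          (1# + 1#) · x        ≡⟨ distribʳ x 1# 1# ⟩
          (1# · x) + (1# · x)  ≡⟨ cong₂ _+_ (*-identityˡ x) (*-identityˡ x) ⟩
          x + x                ≡⟨ cong (x +_) -x≡x ⟨
          x + (- x)            ≡⟨ -‿inverseʳ x ⟩
          0#                   ∎
    ... | inj₁ 2≡0 = ⊥-elim (two≢0 2≡0)
    ... | inj₂ x≡0 = x≡0

    -- Half: one element from each pair {x, -x} of nonzero elements, namely the one
    -- with the smaller index.
    open ListCounting.InvolutionCount _≟_ idx -_ elements (λ {x} _ → ∈-elements (- x))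
           (λ {x} _ → -‿involutive x) (λ _ eq → sym (idx-injective eq))
      using () renaming (Below to Half; below? to half?; count to negation-count)

    q≡1+2·|Half| : q ≡ 1 ℕ.+ 2 ℕ.* length Half
    q≡1+2·|Half| = begin
      q                                                     ≡⟨ elements-length ⟨
      length elements                                       ≡⟨ negation-count elements-unique ⟩
      length (filter (λ x → (- x) ≟ x) elements) ℕ.+ 2 ℕ.* length Half
                                                            ≡⟨ cong (ℕ._+ 2 ℕ.* length Half) only-zero ⟩
      1 ℕ.+ 2 ℕ.* length Half                               ∎
      where
        only-zero : length (filter (λ x → (- x) ≟ x) elements) ≡ 1
        only-zero = ListCounting.filter-length _≟_ (λ x → (- x) ≟ x) elements (0# ∷ []) elements-unique
          (All.[] ∷ [])
          (λ _ -x≡x → here (neg-fixed⇒zero -x≡x))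
          (λ { (here refl) → ∈-elements 0# , -0#≈0# })

    index-below : ∀ {x} → x ∈ Half → idx x ℕ.< idx (- x)
    index-below = proj₂ ∘ ∈-filter⁻ half? {xs = elements}

    square-injective : ∀ {x y} → x ∈ 0# ∷ Half → y ∈ 0# ∷ Half → x · x ≡ y · y → x ≡ y
    square-injective x∈ y∈ xx≡yy with equal-squares xx≡yy
    ... | inj₁ x≡y = x≡y
    ... | inj₂ x≡-y = opposite x∈ y∈ x≡-y
      where
        opposite : ∀ {x y} → x ∈ 0# ∷ Half → y ∈ 0# ∷ Half → x ≡ - y → x ≡ y
        opposite {y = y} (here refl) _ 0≡-y = sym (begin
          y          ≡⟨ -‿involutive y ⟨
          - (- y)    ≡⟨ cong -_ 0≡-y ⟨
          - 0#       ≡⟨ -0#≈0# ⟩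
          0#         ∎)
        opposite (there _) (here refl) x≡-0 = trans x≡-0 -0#≈0#
        opposite {x} {y} (there x∈H) (there y∈H) x≡-y = ⊥-elim (ℕP.<-asym idx-x<idx-y idx-y<idx-x)
          where
            idx-x<idx-y : idx x ℕ.< idx y
            idx-x<idx-y = subst (λ z → idx x ℕ.< idx z) (trans (cong -_ x≡-y) (-‿involutive y))
                                (index-below x∈H)
            idx-y<idx-x : idx y ℕ.< idx x
            idx-y<idx-x = subst (λ z → idx y ℕ.< idx z) (sym x≡-y) (index-below y∈H)

    Zero∷Half-unique : Unique (0# ∷ Half)
    Zero∷Half-unique = All.tabulate 0∉Half ∷ filter⁺ half? elements-unique
      where
        0∉Half : ∀ {x} → x ∈ Half → ¬ 0# ≡ x
        0∉Half x∈H refl = ℕP.<-irrefl (cong idx (sym -0#≈0#)) (index-below x∈H)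

    -- In a field of odd order -1 is a sum of two squares: a ↦ a² and b ↦ -(1 + b²) are
    -- injective on 0 ∷ Half, which holds (q + 1)/2 elements, so their images meet.
    sum-of-two-squares : ∃ λ a → ∃ λ b → (a · a) + (b · b) ≡ - 1#
    sum-of-two-squares
      with ListCounting.images-meet _≟_ (λ a → a · a) (λ b → - (1# + (b · b))) (0# ∷ Half) elements
             Zero∷Half-unique square-injective shifted-injective ∈-elements more-than-half
      where
        shifted-injective : ∀ {b c} → b ∈ 0# ∷ Half → c ∈ 0# ∷ Half →
                            - (1# + (b · b)) ≡ - (1# + (c · c)) → b ≡ c
        shifted-injective {b} {c} b∈ c∈ eq = square-injective b∈ c∈ (+-cancelˡ 1# (b · b) (c · c) (-‿injective eq))
        more-than-half : length elements ℕ.< 2 ℕ.* length (0# ∷ Half)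
        more-than-half = subst₂ ℕ._<_ (sym (trans elements-length q≡1+2·|Half|))
                                      (sym (ℕP.*-suc 2 (length Half))) (ℕP.n<1+n _)
    ... | a , b , aa≡-[1+bb] = a , b , +-inverseˡ-unique ((a · a) + (b · b)) 1# (begin
      ((a · a) + (b · b)) + 1#                 ≡⟨ +-assoc (a · a) (b · b) 1# ⟩
      (a · a) + ((b · b) + 1#)                 ≡⟨ cong₂ _+_ aa≡-[1+bb] (+-comm (b · b) 1#) ⟩
      (- (1# + (b · b))) + (1# + (b · b))      ≡⟨ -‿inverseˡ (1# + (b · b)) ⟩
      0#                                       ∎)

    -- Inversion fixes exactly 1 and -1 among the nonzero elements, as x⁻¹ = x means x² = 1.
    inverse-fixed-count : length (filter (λ x → (x ⁻¹) ≟ x) Nonzero) ≡ 2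
    inverse-fixed-count = ListCounting.filter-length _≟_ (λ x → (x ⁻¹) ≟ x) Nonzero (1# ∷ - 1# ∷ [])
      Nonzero-unique ((1≢-1 All.∷ All.[]) ∷ All.[] ∷ []) sound complete
      where
        1≢-1 : ¬ 1# ≡ - 1#
        1≢-1 1≡-1 = 1≢0 (neg-fixed⇒zero (sym 1≡-1))
        sound : ∀ {x} → x ∈ Nonzero → x ⁻¹ ≡ x → x ∈ 1# ∷ - 1# ∷ []
        sound {x} x∈ x⁻¹≡x with equal-squares (trans (cong (x ·_) (sym x⁻¹≡x))
                                  (trans (⁻¹-inverse (nonzero x∈)) (sym (*-identityˡ 1#))))
        ... | inj₁ x≡1 = here x≡1
        ... | inj₂ x≡-1 = there (here x≡-1)
        complete : ∀ {y} → y ∈ 1# ∷ - 1# ∷ [] → y ∈ Nonzero × y ⁻¹ ≡ y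
        complete (here refl) = nonzero⁺ 1≢0 , sym (inverse-unique (*-identityˡ 1#))
        complete (there (here refl)) = nonzero⁺ (neg-nonzero 1≢0) ,
          sym (inverse-unique (trans (neg-·-neg 1# 1#) (*-identityˡ 1#)))

    -- Without a square root of -1, negation and inversion are commuting involutions of
    -- the nonzero elements such that neither negation nor x ↦ -x⁻¹ has a fixed point;
    -- counting orbits of the group they generate gives q - 1 ≡ 2 (mod 4).
    no-root⇒q≡3 : (∀ x → ¬ x · x ≡ - 1#) → ∃ λ m → q ≡ 3 ℕ.+ 4 ℕ.* m
    no-root⇒q≡3 no-root = m , (begin
      q                                                                   ≡⟨ q≡1+|Nonzero| ⟩
      1 ℕ.+ length Nonzero                                                ≡⟨ cong (1 ℕ.+_) |Nonzero|≡|Fixed|+4m ⟩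
      1 ℕ.+ (length (filter (λ x → (x ⁻¹) ≟ x) Nonzero) ℕ.+ 4 ℕ.* m)     ≡⟨ cong (λ n → 1 ℕ.+ (n ℕ.+ 4 ℕ.* m)) inverse-fixed-count ⟩
      3 ℕ.+ 4 ℕ.* m                                                       ∎)
      where
        -- a fixed point x = -x⁻¹ would satisfy x² = -1
        -x⁻¹-free : ∀ {x} → x ∈ Nonzero → ¬ - (x ⁻¹) ≡ x
        -x⁻¹-free {x} x∈ -x⁻¹≡x = no-root x (begin
          x · x            ≡⟨ cong (x ·_) -x⁻¹≡x ⟨
          x · (- (x ⁻¹))   ≡⟨ -‿distribʳ-* x (x ⁻¹) ⟨
          - (x · (x ⁻¹))   ≡⟨ cong -_ (⁻¹-inverse (nonzero x∈)) ⟩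
          - 1#             ∎)
        orbits : ∃ λ m → length Nonzero ≡ length (filter (λ x → (x ⁻¹) ≟ x) Nonzero) ℕ.+ 4 ℕ.* m
        orbits = klein-four-count -_ _⁻¹ Nonzero Nonzero-unique
          (λ x∈ → nonzero⁺ (neg-nonzero (nonzero x∈))) (λ x∈ → nonzero⁺ (⁻¹-nonzero (nonzero x∈)))
          (λ {x} _ → -‿involutive x) (λ x∈ → ⁻¹-involutive (nonzero x∈)) (λ x∈ → sym (⁻¹-neg (nonzero x∈)))
          (λ x∈ -x≡x → nonzero x∈ (neg-fixed⇒zero -x≡x)) -x⁻¹-free
        m : ℕ
        m = proj₁ orbits
        |Nonzero|≡|Fixed|+4m : length Nonzero ≡ length (filter (λ x → (x ⁻¹) ≟ x) Nonzero) ℕ.+ 4 ℕ.* m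
        |Nonzero|≡|Fixed|+4m = proj₂ orbits

    square-root-of-minus-one : q ℕ.% 4 ≡ 1 → ∃ λ i → i · i ≡ - 1#
    square-root-of-minus-one q%4≡1 = from-search (any? (λ i → (i · i) ≟ (- 1#)) elements)
      where
        from-search : Dec (Any.Any (λ i → i · i ≡ - 1#) elements) → ∃ λ i → i · i ≡ - 1#
        from-search (yes found) = Any.satisfied found
        from-search (no none) = ⊥-elim (q≢3+4m (no-root⇒q≡3 (λ x xx≡-1 → none (lose (∈-elements x) xx≡-1))))
          where
            q≢3+4m : ¬ ∃ λ m → q ≡ 3 ℕ.+ 4 ℕ.* m
            q≢3+4m (m , q≡3+4m) = Residues.3+4m%4≢1 m (trans (cong (ℕ._% 4) (sym q≡3+4m)) q%4≡1)

module Geometry (F : FiniteField) where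

  open import Algebra.Bundles using (CommutativeRing)
  open import Algebra.Structures using (IsCommutativeRing)
  open import Data.Nat using (ℕ; zero; suc; _^_)
  import Data.Nat as ℕ
  import Data.Nat.Properties as ℕP
  open import Data.Vec using (Vec; []; _∷_; replicate)
  import Data.Vec as Vec
  open import Data.Vec.Properties using (∷-injective; ∷-injectiveˡ; ≡-dec)
  open import Data.List using (List; []; _∷_; length; map; filter; cartesianProductWith)
  open import Data.List.Properties using (length-map)
  open import Data.List.Membership.Propositional using (_∈_; _∉_)
  open import Data.List.Membership.Propositional.Properties using (∈-map⁻; ∈-filter⁻; ∈-cartesianProductWith⁺)
  open import Data.List.Relation.Unary.Any using (here)
  open import Data.List.Relation.Unary.Unique.Propositional using (Unique)
  open import Data.List.Relation.Unary.Unique.Propositional.Properties using (map⁺; filter⁺; cartesianProductWith⁺)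
  import Data.List.Relation.Unary.All as All
  open import Data.List.Relation.Unary.AllPairs using ([]; _∷_)
  open import Data.Product using (Σ; ∃; _×_; _,_; proj₂)
  open import Data.Sum using (_⊎_; inj₁; inj₂)
  open import Function using (_∘_)
  open import Relation.Nullary using (¬_; ¬?)
  open import Relation.Unary using (Decidable)
  open import Relation.Binary.PropositionalEquality
  open ≡-Reasoning

  open FiniteField F
  open FiniteFieldFacts F
  open IsCommutativeRing isCommutativeRing
    using (+-assoc; +-comm; +-identityˡ; +-identityʳ; -‿inverseʳ; *-assoc; *-comm; *-identityˡ; *-identityʳ;
           distribˡ; distribʳ; zeroˡ; zeroʳ)
  open import Algebra.Properties.Ring (CommutativeRing.ring commutativeRing)
    using (-0#≈0#; -‿+-comm; x[y-z]≈xy-xz; [y-z]x≈yx-zx; +-inverseˡ-unique; x∙y⁻¹≈ε⇒x≈y)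
  open import Algebra.Properties.CommutativeSemigroup (CommutativeRing.+-commutativeSemigroup commutativeRing)
    using (interchange)

  infixl 6 _−_
  infix 7 _∙_
  infixr 7 _⋆_

  _−_ : ∀ {d} → Point F d → Point F d → Point F d
  _−_ = _-ᵥ_ F

  _∙_ : ∀ {d} → Point F d → Point F d → Carrier
  _∙_ = dot F

  _⋆_ : ∀ {d} → Carrier → Point F d → Point F d
  t ⋆ u = Vec.map (t ·_) u

  ∙-comm : ∀ {d} (u z : Point F d) → u ∙ z ≡ z ∙ u
  ∙-comm [] [] = refl
  ∙-comm (a ∷ u) (b ∷ z) = cong₂ _+_ (*-comm a b) (∙-comm u z)

  ⋆-∙ : ∀ {d} t (u z : Point F d) → (t ⋆ u) ∙ z ≡ t · (u ∙ z)
  ⋆-∙ t [] [] = sym (zeroʳ t)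
  ⋆-∙ t (a ∷ u) (b ∷ z) = trans (cong₂ _+_ (*-assoc t a b) (⋆-∙ t u z)) (sym (distribˡ t (a · b) (u ∙ z)))

  ∙-⋆ : ∀ {d} t (u z : Point F d) → u ∙ (t ⋆ z) ≡ t · (u ∙ z)
  ∙-⋆ t u z = trans (∙-comm u (t ⋆ z)) (trans (⋆-∙ t z u) (cong (t ·_) (∙-comm z u)))

  ∙-− : ∀ {d} (u z w : Point F d) → u ∙ (z − w) ≡ (u ∙ z) + (- (u ∙ w))
  ∙-− [] [] [] = sym (trans (cong (0# +_) -0#≈0#) (+-identityʳ 0#))
  ∙-− (a ∷ u) (b ∷ z) (c ∷ w) = begin
    (a · (b + (- c))) + (u ∙ (z − w))                     ≡⟨ cong₂ _+_ (x[y-z]≈xy-xz a b c) (∙-− u z w) ⟩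
    ((a · b) + (- (a · c))) + ((u ∙ z) + (- (u ∙ w)))     ≡⟨ interchange (a · b) (- (a · c)) (u ∙ z) (- (u ∙ w)) ⟩
    ((a · b) + (u ∙ z)) + ((- (a · c)) + (- (u ∙ w)))     ≡⟨ cong (((a · b) + (u ∙ z)) +_) (-‿+-comm (a · c) (u ∙ w)) ⟩
    ((a · b) + (u ∙ z)) + (- ((a · c) + (u ∙ w)))         ∎

  ⋆-− : ∀ {d} s t (v : Point F d) → (s ⋆ v) − (t ⋆ v) ≡ (s + (- t)) ⋆ v
  ⋆-− s t [] = refl
  ⋆-− s t (a ∷ v) = cong₂ _∷_ (sym ([y-z]x≈yx-zx a s t)) (⋆-− s t v)

  points : (d : ℕ) → List (Point F d)
  points zero = [] ∷ []
  points (suc d) = cartesianProductWith _∷_ elements (points d)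

  ∈-points : ∀ {d} (z : Point F d) → z ∈ points d
  ∈-points [] = here refl
  ∈-points (a ∷ z) = ∈-cartesianProductWith⁺ _∷_ (∈-elements a) (∈-points z)

  points-unique : ∀ d → Unique (points d)
  points-unique zero = All.[] ∷ []
  points-unique (suc d) = cartesianProductWith⁺ _∷_ ∷-injective elements-unique (points-unique d)

  points-length : ∀ d → length (points d) ≡ q ^ d
  points-length zero = refl
  points-length (suc d) = trans (ListCounting.length-cartesianProductWith _∷_ elements (points d))
                                (cong₂ ℕ._*_ elements-length (points-length d))

  -- The configuration for an isotropic vector v = (1, w), i.e. w · w = -1: the line
  -- A = F·v and the set B of points z with v · z ≠ 0. For x = s v, y = t v in A and any z,
  -- (x - y) · (z - y) = (s - t)(v · z), which vanishes only if x = y or z ∉ B.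
  module IsotropicLine {e : ℕ} (w : Point F e) (w∙w≡-1 : w ∙ w ≡ - 1#) where

    v : Point F (suc e)
    v = 1# ∷ w

    v-isotropic : v ∙ v ≡ 0#
    v-isotropic = trans (cong₂ _+_ (*-identityʳ 1#) w∙w≡-1) (-‿inverseʳ 1#)

    Line : List (Point F (suc e))
    Line = map (_⋆ v) elements

    orthogonal? : Decidable (λ z → v ∙ z ≡ 0#)
    orthogonal? z = (v ∙ z) ≟ 0#

    Orthogonal Far : List (Point F (suc e))
    Orthogonal = filter orthogonal? (points (suc e))
    Far = filter (¬? ∘ orthogonal?) (points (suc e))

    -- the first coordinate of t ⋆ v is t
    Line-unique : Unique Line
    Line-unique = map⁺ (λ {s} {t} eq → trans (sym (*-identityʳ s)) (trans (∷-injectiveˡ eq) (*-identityʳ t)))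
                       elements-unique

    Line-length : length Line ≡ q
    Line-length = trans (length-map (_⋆ v) elements) elements-length

    Far-unique : Unique Far
    Far-unique = filter⁺ (¬? ∘ orthogonal?) (points-unique (suc e))

    far : ∀ {z} → z ∈ Far → ¬ v ∙ z ≡ 0#
    far = proj₂ ∘ ∈-filter⁻ (¬? ∘ orthogonal?) {xs = points (suc e)}

    line-orthogonal : ∀ t → v ∙ (t ⋆ v) ≡ 0#
    line-orthogonal t = trans (∙-⋆ t v v) (trans (cong (t ·_) v-isotropic) (zeroʳ t))

    Line∩Far : ∀ x → x ∈ Line → x ∉ Far
    Line∩Far x x∈Line x∈Far with ∈-map⁻ (_⋆ v) x∈Line
    ... | t , _ , refl = far x∈Far (line-orthogonal t)

    -- A point orthogonal to v is determined by its last e coordinates.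
    Orthogonal-length : length Orthogonal ℕ.≤ q ^ e
    Orthogonal-length = ℕP.≤-trans
      (ListCounting.length-≤-by-injection (≡-dec _≟_) Vec.tail Orthogonal (points e)
        (filter⁺ orthogonal? (points-unique (suc e))) same-tail (λ {z} _ → ∈-points (Vec.tail z)))
      (ℕP.≤-reflexive (points-length e))
      where
        head-determined : ∀ {a z} → (a ∷ z) ∈ Orthogonal → a ≡ - (w ∙ z)
        head-determined {a} {z} a∷z∈ = +-inverseˡ-unique a (w ∙ z)
          (trans (cong (_+ (w ∙ z)) (sym (*-identityˡ a))) (proj₂ (∈-filter⁻ orthogonal? {xs = points (suc e)} a∷z∈)))
        same-tail : ∀ {x y} → x ∈ Orthogonal → y ∈ Orthogonal → Vec.tail x ≡ Vec.tail y → x ≡ y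
        same-tail {a ∷ z} {b ∷ .z} a∷z∈ b∷z∈ refl = cong (_∷ z) (trans (head-determined a∷z∈) (sym (head-determined b∷z∈)))

    points-split : q ^ suc e ≡ length Orthogonal ℕ.+ length Far
    points-split = trans (sym (points-length (suc e))) (ListCounting.length-split orthogonal? (points (suc e)))

    right-angle-form : ∀ s t z → ((s ⋆ v) − (t ⋆ v)) ∙ (z − (t ⋆ v)) ≡ (s + (- t)) · (v ∙ z)
    right-angle-form s t z = begin
      ((s ⋆ v) − (t ⋆ v)) ∙ (z − (t ⋆ v))          ≡⟨ cong (_∙ (z − (t ⋆ v))) (⋆-− s t v) ⟩
      ((s + (- t)) ⋆ v) ∙ (z − (t ⋆ v))             ≡⟨ ⋆-∙ (s + (- t)) v (z − (t ⋆ v)) ⟩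
      (s + (- t)) · (v ∙ (z − (t ⋆ v)))             ≡⟨ cong ((s + (- t)) ·_) (∙-− v z (t ⋆ v)) ⟩
      (s + (- t)) · ((v ∙ z) + (- (v ∙ (t ⋆ v))))   ≡⟨ cong (λ u → (s + (- t)) · ((v ∙ z) + (- u))) (line-orthogonal t) ⟩
      (s + (- t)) · ((v ∙ z) + (- 0#))              ≡⟨ cong (λ u → (s + (- t)) · ((v ∙ z) + u)) -0#≈0# ⟩
      (s + (- t)) · ((v ∙ z) + 0#)                  ≡⟨ cong ((s + (- t)) ·_) (+-identityʳ (v ∙ z)) ⟩
      (s + (- t)) · (v ∙ z)                         ∎

    no-right-angle : ¬ (∃ λ x → ∃ λ y → ∃ λ z → x ∈ Line × y ∈ Line × z ∈ Far × RightAngle F x y z)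
    no-right-angle (x , y , z , x∈Line , y∈Line , z∈Far , x≢y , _ , _ , angle)
      with ∈-map⁻ (_⋆ v) x∈Line | ∈-map⁻ (_⋆ v) y∈Line
    ... | s , _ , refl | t , _ , refl with zero-product (trans (sym (right-angle-form s t z)) angle)
    ...   | inj₁ s-t≡0 = x≢y (cong (_⋆ v) (x∙y⁻¹≈ε⇒x≈y s t s-t≡0))
    ...   | inj₂ v∙z≡0 = far z∈Far v∙z≡0

    -- |A| = q and |B| = q^(e+1) - |Orthogonal| with |Orthogonal| ≤ q^e.
    size-estimate : ∀ k → suc k ℕ.≤ q →
      suc k ℕ.* ℕ.∣ length Line ℕ.* length Line ℕ.* length Far - q ^ (suc e ℕ.+ 2) ∣ ℕ.≤ q ^ (suc e ℕ.+ 2)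
    size-estimate k k<q rewrite Line-length =
      SizeEstimate.deviation-bound q k e (length Orthogonal) (length Far) k<q points-split Orthogonal-length

  zeros-∙-zeros : ∀ d → replicate d 0# ∙ replicate d 0# ≡ 0#
  zeros-∙-zeros zero = refl
  zeros-∙-zeros (suc d) = trans (cong₂ _+_ (zeroˡ 0#) (zeros-∙-zeros d)) (+-identityˡ 0#)

  -- Over a field of odd order, -1 is the square norm w · w of some w ∈ F^e whenever
  -- e ≥ 2 (as -1 is a sum of two squares), or e = 1 and q ≡ 1 (mod 4).
  minus-one-as-norm : q ℕ.% 2 ≡ 1 → ∀ e → (3 ℕ.≤ suc e ⊎ (suc e ≡ 2 × q ℕ.% 4 ≡ 1)) →
    Σ (Point F e) λ w → w ∙ w ≡ - 1#
  minus-one-as-norm q-odd zero (inj₁ (ℕ.s≤s ()))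
  minus-one-as-norm q-odd zero (inj₂ (() , _))
  minus-one-as-norm q-odd (suc zero) (inj₁ (ℕ.s≤s (ℕ.s≤s ())))
  minus-one-as-norm q-odd (suc zero) (inj₂ (_ , q%4≡1)) =
    let (i , i²≡-1) = OddOrder.square-root-of-minus-one q-odd q%4≡1
    in (i ∷ []) , trans (+-identityʳ (i · i)) i²≡-1
  minus-one-as-norm q-odd (suc (suc e)) _ =
    let (a , b , a²+b²≡-1) = OddOrder.sum-of-two-squares q-odd
    in (a ∷ b ∷ replicate e 0#) , (begin
      (a · a) + ((b · b) + (replicate e 0# ∙ replicate e 0#))  ≡⟨ cong (λ c → (a · a) + ((b · b) + c)) (zeros-∙-zeros e) ⟩
      (a · a) + ((b · b) + 0#)                                ≡⟨ cong ((a · a) +_) (+-identityʳ (b · b)) ⟩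
      (a · a) + (b · b)                                       ≡⟨ a²+b²≡-1 ⟩
      - 1#                                                    ∎)

open import Data.Nat using (ℕ; zero; suc; _+_; _*_; _^_; _%_; _≤_; ∣_-_∣)
open import Data.List using (List; length)
open import Data.List.Membership.Propositional using (_∈_; _∉_)
open import Data.List.Relation.Unary.Unique.Propositional using (Unique)
open import Data.Product using (_×_; Σ; ∃; _,_)
open import Data.Sum using (_⊎_; inj₁; inj₂)
open import Relation.Nullary using (¬_)
open import Relation.Binary.PropositionalEquality using (_≡_)

-- The o(1) term is made explicit: for q ≥ N = k + 1 the relative error of |A|²|B| is at
-- most 1/(k + 1).
mainTheorem5 :
    (d : ℕ) →
    (k : ℕ) →
    Σ ℕ λ N →
    (F : FiniteField) →
    let q = FiniteField.size F in
    N ≤ q →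
    OddPrimePower q →
    (3 ≤ d ⊎ (d ≡ 2 × q % 4 ≡ 1)) →
    Σ (List (Point F d)) λ A →
    Σ (List (Point F d)) λ B →
    Unique A × Unique B ×
    (∀ x → x ∈ A → x ∉ B) ×
    (suc k * ∣ length A * length A * length B - q ^ (d + 2) ∣ ≤ q ^ (d + 2)) ×
    ¬ (∃ λ x → ∃ λ y → ∃ λ z → x ∈ A × y ∈ A × z ∈ B × RightAngle F x y z)
mainTheorem5 zero k = suc k , λ { _ _ _ (inj₁ ()) ; _ _ _ (inj₂ (() , _)) }
mainTheorem5 (suc e) k = suc k , λ F k<q q-power dimension →
  let open Geometry F
      (w , w∙w≡-1) = minus-one-as-norm (Residues.odd-prime-power-odd q-power) e dimension
      open IsotropicLine w w∙w≡-1
  in Line , Far , Line-unique , Far-unique , Line∩Far , size-estimate k k<q , no-right-angle
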